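{- For all integers $n,k\ge1$ and every $\pi\in\mathcal{OP}_n^k$: $$(\mathrm{mak}+\mathrm{bInv})(\pi)=(\mathrm{lcs}+\mathrm{rcs})(\pi)+\mathrm{rsb}(\mathcal T\cup\mathcal C)(\pi)+\mathrm{inv}(\pi),$$ $$(\mathrm{lmak}+\mathrm{bInv})(\pi)=n(k-1)-(\mathrm{lcs}+\mathrm{rcs})(\mathcal T\cup\mathcal C)(\pi)-\mathrm{lsb}(\mathcal T\cup\mathcal C)(\pi)-\mathrm{cinv}(\pi),$$ $$\mathrm{cinvLSB}(\pi)=(\mathrm{lsb}+\mathrm{rsb})(\mathcal O\cup\mathcal S)(\pi)+\mathrm{lsb}(\mathcal T\cup\mathcal C)(\pi)+\mathrm{inv}(\pi)+2\,\mathrm{cinv}(\pi).$$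
   Context: $\mathcal{OP}_n^k$: sequences $\pi=(B_1,\dots,B_k)$ of nonempty pairwise disjoint sets with union $[n]$. Opener/closer = least/greatest element of a block; $\mathrm{open}(\pi)$, $\mathrm{clos}(\pi)$; $\mathrm{block}(i)=j$ iff $i\in B_j$. For $i\in[n]$: $\mathrm{ros}_i=\#\{j\in\mathrm{open}(\pi): j<i,\ \mathrm{block}(j)>\mathrm{block}(i)\}$, $\mathrm{los}_i=\#\{j\in\mathrm{open}(\pi): j<i,\ \mathrm{block}(j)<\mathrm{block}(i)\}$, $\mathrm{rcs}_i=\#\{j\in\mathrm{clos}(\pi): j<i,\ \mathrm{block}(j)>\mathrm{block}(i)\}$, $\mathrm{lcs}_i=\#\{j\in\mathrm{clos}(\pi): j<i,\ \mathrm{block}(j)<\mathrm{block}(i)\}$; $\mathrm{rsb}_i$ (resp. $\mathrm{lsb}_i$) = number of blocks $B$ to the right (resp. left) of the block containing $i$ with $\min B<i<\max B$. For a coordinate statistic $s$: $s(\pi)=\sum_{i\in[n]}s_i(\pi)$ and $s(A)(\pi)=\sum_{i\in A(\pi)}s_i(\pi)$ for a set-valued $A$; sums taken coordinatewise. Types: singletons $\mathcal S(\pi)$ (elements of one-element blocks); in blocks of size $\ge2$: strict openers $\mathcal O(\pi)$ (minima), strict closers $\mathcal C(\pi)$ (maxima), transients $\mathcal T(\pi)$ (others). $\mathrm{bInv}(\pi)$ = number of pairs $a<b$ with every element of $B_a$ greater than every element of $B_b$. $\mathrm{inv}(\pi)$ = number of pairs $a<b$ with $\min B_a>\min B_b$;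 $\mathrm{cinv}=\binom k2-\mathrm{inv}$. $\mathrm{mak}=\mathrm{ros}+\mathrm{lcs}$, $\mathrm{lmak}=n(k-1)-(\mathrm{los}+\mathrm{rcs})$, $\mathrm{cinvLSB}=\mathrm{lsb}+\bigl(\binom k2-\mathrm{bInv}\bigr)+\binom k2$. -}

module Defs where

open import Data.Nat using (ℕ; zero; suc; _<ᵇ_; _⊔_; _⊓_)
open import Data.Bool using (Bool; true; false; if_then_else_; _∧_; _∨_; not)
open import Data.Fin using (Fin; toℕ)
import Data.Fin as Fin
open import Data.List using (List; map; foldr; filter; length)
open import Data.Nat.ListAction using (sum)
open import Data.Bool.ListAction using (all)
open import Data.List.Base using (allFin)
open import Relation.Nullary.Decidable using (⌊_⌋)
open import Data.Product using (Σ)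
open import Relation.Binary.PropositionalEquality using (_≡_)

-- An ordered set partition π = (B_1,…,B_k) of [n] into k blocks is encoded
-- by its block map  block : Fin n → Fin k  (i ∈ B_{block i}), which must be
-- surjective (all blocks nonempty).  Elements of [n] are Fin n (0-based, order
-- preserved); block indices are Fin k (0-based, order preserved).

_<F_ : ∀ {m} → Fin m → Fin m → Bool
a <F b = toℕ a <ᵇ toℕ b

_==F_ : ∀ {m} → Fin m → Fin m → Bool
a ==F b = ⌊ a Fin.≟ b ⌋

count : ∀ m → (Fin m → Bool) → ℕ
count m p = length (filter (λ i → p i Data.Bool.≟ true) (allFin m))
  where import Data.Bool

sumOver : ∀ m → (Fin m → Bool) → (Fin m → ℕ) → ℕ
sumOver m A s = sum (map (λ i → if A i then s i else 0) (allFin m))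

sumAll : ∀ m → (Fin m → ℕ) → ℕ
sumAll m s = sumOver m (λ _ → true) s

module _ {n k : ℕ} (block : Fin n → Fin k) where

  -- least / greatest element (as natural number) of block b
  -- (defaults n resp. 0 are only used for empty blocks, which do not occur)
  minB : Fin k → ℕ
  minB b = foldr (λ j m → if block j ==F b then toℕ j ⊓ m else m) n (allFin n)

  maxB : Fin k → ℕ
  maxB b = foldr (λ j m → if block j ==F b then toℕ j ⊔ m else m) 0 (allFin n)

  isOpen : Fin n → Bool
  isOpen i = ⌊ toℕ i Data.Nat.≟ minB (block i) ⌋
    where import Data.Nat

  isClos : Fin n → Bool
  isClos i = ⌊ toℕ i Data.Nat.≟ maxB (block i) ⌋
    where import Data.Nat

  isS isO isC isT : Fin n → Bool
  isS i = isOpen i ∧ isClos i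
  isO i = isOpen i ∧ not (isClos i)
  isC i = isClos i ∧ not (isOpen i)
  isT i = not (isOpen i) ∧ not (isClos i)

  ros los rcs lcs rsb lsb : Fin n → ℕ
  ros i = count n (λ j → isOpen j ∧ (j <F i) ∧ (block i <F block j))
  los i = count n (λ j → isOpen j ∧ (j <F i) ∧ (block j <F block i))
  rcs i = count n (λ j → isClos j ∧ (j <F i) ∧ (block i <F block j))
  lcs i = count n (λ j → isClos j ∧ (j <F i) ∧ (block j <F block i))
  rsb i = count k (λ b → (block i <F b) ∧ (minB b <ᵇ toℕ i) ∧ (toℕ i <ᵇ maxB b))
  lsb i = count k (λ b → (b <F block i) ∧ (minB b <ᵇ toℕ i) ∧ (toℕ i <ᵇ maxB b))

  allGreater : Fin k → Fin k → Bool
  allGreater a b = all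
    (λ x → all (λ y → not (block x ==F a) ∨ not (block y ==F b) ∨ (y <F x)) (allFin n))
    (allFin n)

  bInv : ℕ
  bInv = sumAll k (λ a → count k (λ b → (a <F b) ∧ allGreater a b))

  inv : ℕ
  inv = sumAll k (λ a → count k (λ b → (a <F b) ∧ (minB b <ᵇ minB a)))

IsOSP : ∀ {n k} → (Fin n → Fin k) → Set
IsOSP {n} {k} block = ∀ (b : Fin k) → Σ (Fin n) (λ i → block i ≡ b)

module _ {n k : ℕ} (block : Fin n → Fin k) where
  open import Data.Integer using (ℤ; +_; _+_; _-_; _*_)
  open import Data.Nat.Combinatorics using (_C_)

  -- s(π) and s(A)(π) as integers
  tot : (Fin n → ℕ) → ℤ
  tot s = + sumAll n s

  totOn : (Fin n → Bool) → (Fin n → ℕ) → ℤ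
  totOn A s = + sumOver n A s

  isTC isOS : Fin n → Bool
  isTC i = isT block i ∨ isC block i
  isOS i = isO block i ∨ isS block i

  mak : ℤ
  mak = tot (ros block) + tot (lcs block)

  lmak : ℤ
  lmak = (+ n * (+ k - + 1)) - (tot (los block) + tot (rcs block))

  cinv : ℤ
  cinv = + (k C 2) - + inv block

  cinvLSB : ℤ
  cinvLSB = (tot (lsb block) + (+ (k C 2) - + bInv block)) + + (k C 2)

module Submission where

-- Every statistic counts pairs (element i, block b). Each block has exactly one opener, its
-- minimum, and one closer, so a count over openers j of a condition on (block j, j) equals the
-- count over blocks b of that condition on (b, min b). This turns ros, los, rcs, lcs into counts of
-- blocks to the right/left of i that opened/closed before i, and inv, bInv into the sums of ros,
-- rcs over openers. A block other than block(i) that opened before i has either closed before i or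
-- straddles i, whence ros = rcs + rsb and los = lcs + lsb. Together with
-- binom(k,2) = inv + (sum of los over openers) and the splitting of every total into its parts over
-- openers (O ∪ S) and non-openers (T ∪ C), the three identities follow linearly.

open import Defs
open import Data.Nat using (ℕ; _≥_)
open import Data.Fin using (Fin)
open import Data.Bool using (Bool)
open import Data.Product using (_×_)
open import Relation.Binary.PropositionalEquality using (_≡_)

module Booleans where
  open import Data.Nat using (_+_; _<ᵇ_; _<_)
  open import Data.Nat.Properties using (<ᵇ-reflects-<; <-cmp)
  open import Data.Bool using (true; false; not; _∧_; _∨_; T)
  open import Data.Unit using (tt)
  open import Function.Bundles using (_⇔_; mk⇔)
  open import Relation.Nullary using (Dec; yes; no; ¬_)
  open import Relation.Nullary.Decidable using (⌊_⌋; isYes≗does; dec-true; dec-false)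
  open import Relation.Nullary.Reflects using (ofʸ; ofⁿ; det)
  open import Relation.Binary using (tri<; tri≈; tri>)
  open import Relation.Binary.PropositionalEquality using (refl; trans; _≢_)
  open import Data.Empty using (⊥-elim)
  open import Data.List using (allFin)
  open import Data.Bool.ListAction using (all)
  open import Data.List.Relation.Unary.All.Properties using (all⁺; all⁻; tabulate⁺; tabulate⁻)
  open import Function using (_∘_)

  𝟙 : Bool → ℕ
  𝟙 true  = 1
  𝟙 false = 0

  <ᵇ-true : ∀ {m n} → m < n → (m <ᵇ n) ≡ true
  <ᵇ-true m<n = det (<ᵇ-reflects-< _ _) (ofʸ m<n)

  <ᵇ-false : ∀ {m n} → ¬ m < n → (m <ᵇ n) ≡ false
  <ᵇ-false m≮n = det (<ᵇ-reflects-< _ _) (ofⁿ m≮n)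

  ⌊⌋-true : ∀ {P : Set} (P? : Dec P) → P → ⌊ P? ⌋ ≡ true
  ⌊⌋-true P? p = trans (isYes≗does P?) (dec-true P? p)

  ⌊⌋-false : ∀ {P : Set} (P? : Dec P) → ¬ P → ⌊ P? ⌋ ≡ false
  ⌊⌋-false P? ¬p = trans (isYes≗does P?) (dec-false P? ¬p)

  ⌊⌋-sound : ∀ {P : Set} (P? : Dec P) → ⌊ P? ⌋ ≡ true → P
  ⌊⌋-sound (yes p) _ = p

  ⌊⌋-≡ : ∀ {P Q : Set} (P? : Dec P) (Q? : Dec Q) → (P → Q) → (Q → P) → ⌊ P? ⌋ ≡ ⌊ Q? ⌋
  ⌊⌋-≡ (yes _) (yes _) _   _   = refl
  ⌊⌋-≡ (yes p) (no ¬q) P→Q _   = ⊥-elim (¬q (P→Q p))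
  ⌊⌋-≡ (no ¬p) (yes q) _   Q→P = ⊥-elim (¬p (Q→P q))
  ⌊⌋-≡ (no _)  (no _)  _   _   = refl

  T-not-∨ : ∀ {a b} → T (not a ∨ b) ⇔ (T a → T b)
  T-not-∨ {true}  = mk⇔ (λ b _ → b) (λ f → f tt)
  T-not-∨ {false} = mk⇔ (λ _ ()) (λ _ → tt)

  all-allFin : ∀ {m} (p : Fin m → Bool) → T (all p (allFin m)) ⇔ (∀ i → T (p i))
  all-allFin p = mk⇔ (tabulate⁻ ∘ all⁺ p _) (all⁻ p ∘ tabulate⁺)

  𝟙-∧-split : ∀ s {a b c} → (T s → 𝟙 a ≡ 𝟙 b + 𝟙 c) → 𝟙 (s ∧ a) ≡ 𝟙 (s ∧ b) + 𝟙 (s ∧ c)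
  𝟙-∧-split false _     = refl
  𝟙-∧-split true  split = split tt

  𝟙-<ᵇ-split : ∀ {x y} → x ≢ y → 𝟙 true ≡ 𝟙 (y <ᵇ x) + 𝟙 (x <ᵇ y)
  𝟙-<ᵇ-split {x} {y} x≢y with <-cmp x y
  ... | tri< x<y _ y≮x rewrite <ᵇ-false y≮x | <ᵇ-true x<y = refl
  ... | tri≈ _ x≡y _ = ⊥-elim (x≢y x≡y)
  ... | tri> x≮y _ y<x rewrite <ᵇ-true y<x | <ᵇ-false x≮y = refl

module FiniteSums where
  open import Data.Nat using (zero; suc; _+_)
  open import Data.Nat.Properties using (+-*-semiring; +-identityʳ)
  open import Data.Nat.Combinatorics using (_C_; nC1≡n; nCk+nC[k+1]≡[n+1]C[k+1])
  open import Data.Bool using (true; false; not; if_then_else_; _∧_)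
  import Data.Bool as Bool
  open import Data.Fin using (zero; suc; punchIn)
  open import Data.Fin.Properties using (punchInᵢ≢i)
  open import Data.List using (List; []; _∷_; map; filter; length; tabulate; allFin)
  open import Data.List.Properties using (map-tabulate)
  import Data.Nat.ListAction as List
  open import Function using (_∘_)
  open import Relation.Binary.PropositionalEquality using (refl; sym; trans; cong; cong₂; _≢_)
  open import Algebra.Properties.Semiring.Sum +-*-semiring public
    using (sum-syntax; ∑-distrib-+; ∑-comm; sum-cong-≗; sum-remove; sum-replicate-zero)
  open Booleans

  sum-tabulate : ∀ m (f : Fin m → ℕ) → List.sum (tabulate f) ≡ ∑[ i < m ] f i
  sum-tabulate zero    f = refl
  sum-tabulate (suc m) f = cong (f zero +_) (sum-tabulate m (f ∘ suc))

  sum-map-allFin : ∀ m (f : Fin m → ℕ) → List.sum (map f (allFin m)) ≡ ∑[ i < m ] f i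
  sum-map-allFin m f = trans (cong List.sum (map-tabulate (λ i → i) f)) (sum-tabulate m f)

  length-filter≡sum : ∀ {m} (p : Fin m → Bool) xs →
    length (filter (λ i → p i Bool.≟ true) xs) ≡ List.sum (map (𝟙 ∘ p) xs)
  length-filter≡sum p []       = refl
  length-filter≡sum p (x ∷ xs) with p x
  ... | true  = cong suc (length-filter≡sum p xs)
  ... | false = length-filter≡sum p xs

  count≡∑ : ∀ m (p : Fin m → Bool) → count m p ≡ ∑[ i < m ] 𝟙 (p i)
  count≡∑ m p = trans (length-filter≡sum p (allFin m)) (sum-map-allFin m (𝟙 ∘ p))

  sumOver≡∑ : ∀ m (A : Fin m → Bool) (s : Fin m → ℕ) → sumOver m A s ≡ ∑[ i < m ] (if A i then s i else 0)
  sumOver≡∑ m A s = sum-map-allFin m _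

  sumAll≡∑ : ∀ m (s : Fin m → ℕ) → sumAll m s ≡ ∑[ i < m ] s i
  sumAll≡∑ m s = sum-map-allFin m s

  ∑-point : ∀ {m} (f : Fin m → ℕ) x → (∀ y → y ≢ x → f y ≡ 0) → ∑[ y < m ] f y ≡ f x
  ∑-point {suc m} f x vanish = begin
    ∑[ y < suc m ] f y                ≡⟨ sum-remove {i = x} f ⟩
    f x + ∑[ j < m ] f (punchIn x j)  ≡⟨ cong (f x +_) (sum-cong-≗ λ j → vanish _ (punchInᵢ≢i x j)) ⟩
    f x + ∑[ j < m ] 0                ≡⟨ cong (f x +_) (sum-replicate-zero m) ⟩
    f x + 0                           ≡⟨ +-identityʳ (f x) ⟩
    f x                               ∎
    where open Relation.Binary.PropositionalEquality.≡-Reasoning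

  count≡sumAll : ∀ m (p : Fin m → Bool) → count m p ≡ sumAll m (λ i → 𝟙 (p i))
  count≡sumAll m p = trans (count≡∑ m p) (sym (sumAll≡∑ m _))

  count-cong : ∀ m {p q : Fin m → Bool} → (∀ i → p i ≡ q i) → count m p ≡ count m q
  count-cong m {p} {q} p≗q = trans (count≡∑ m p) (trans (sum-cong-≗ (cong 𝟙 ∘ p≗q)) (sym (count≡∑ m q)))

  count-split : ∀ m {p q r : Fin m → Bool} → (∀ i → 𝟙 (p i) ≡ 𝟙 (q i) + 𝟙 (r i)) →
    count m p ≡ count m q + count m r
  count-split m {p} {q} {r} split = begin
    count m p                                      ≡⟨ count≡∑ m p ⟩
    ∑[ i < m ] 𝟙 (p i)                             ≡⟨ sum-cong-≗ split ⟩
    ∑[ i < m ] (𝟙 (q i) + 𝟙 (r i))                 ≡⟨ ∑-distrib-+ (𝟙 ∘ q) (𝟙 ∘ r) ⟩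
    ∑[ i < m ] 𝟙 (q i) + ∑[ i < m ] 𝟙 (r i)       ≡⟨ sym (cong₂ _+_ (count≡∑ m q) (count≡∑ m r)) ⟩
    count m q + count m r                          ∎
    where open Relation.Binary.PropositionalEquality.≡-Reasoning

  count-∧ : ∀ m (A p : Fin m → Bool) → count m (λ i → A i ∧ p i) ≡ sumOver m A (λ i → 𝟙 (p i))
  count-∧ m A p = trans (count≡∑ m _) (trans (sum-cong-≗ (λ i → indicator (A i))) (sym (sumOver≡∑ m A _)))
    where
    indicator : ∀ a {b} → 𝟙 (a ∧ b) ≡ (if a then 𝟙 b else 0)
    indicator true  = refl
    indicator false = refl

  sumAll-cong : ∀ m {s t : Fin m → ℕ} → (∀ i → s i ≡ t i) → sumAll m s ≡ sumAll m t
  sumAll-cong m {s} {t} s≗t = trans (sumAll≡∑ m s) (trans (sum-cong-≗ s≗t) (sym (sumAll≡∑ m t)))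

  sumOver-cong : ∀ m {A B : Fin m → Bool} {s t : Fin m → ℕ} → (∀ i → A i ≡ B i) → (∀ i → s i ≡ t i) →
    sumOver m A s ≡ sumOver m B t
  sumOver-cong m {A} {B} {s} {t} A≗B s≗t =
    trans (sumOver≡∑ m A s) (trans (sum-cong-≗ (λ i → cong₂ (if_then_else 0) (A≗B i) (s≗t i))) (sym (sumOver≡∑ m B t)))

  sumAll-+ : ∀ m (s t : Fin m → ℕ) → sumAll m (λ i → s i + t i) ≡ sumAll m s + sumAll m t
  sumAll-+ m s t = trans (sumAll≡∑ m _) (trans (∑-distrib-+ s t) (sym (cong₂ _+_ (sumAll≡∑ m s) (sumAll≡∑ m t))))

  sumOver-+ : ∀ m (A : Fin m → Bool) (s t : Fin m → ℕ) →
    sumOver m A (λ i → s i + t i) ≡ sumOver m A s + sumOver m A t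
  sumOver-+ m A s t = trans (sumOver≡∑ m A _) (trans (sum-cong-≗ (λ i → distrib (A i)))
    (trans (∑-distrib-+ {m} _ _) (sym (cong₂ _+_ (sumOver≡∑ m A s) (sumOver≡∑ m A t)))))
    where
    distrib : ∀ a {x y} → (if a then x + y else 0) ≡ (if a then x else 0) + (if a then y else 0)
    distrib true  = refl
    distrib false = refl

  sumAll≡sumOver+sumOver-not : ∀ m (A : Fin m → Bool) (s : Fin m → ℕ) →
    sumAll m s ≡ sumOver m A s + sumOver m (not ∘ A) s
  sumAll≡sumOver+sumOver-not m A s = trans (sumAll≡∑ m s) (trans (sum-cong-≗ (λ i → complement (A i)))
    (trans (∑-distrib-+ {m} _ _) (sym (cong₂ _+_ (sumOver≡∑ m A s) (sumOver≡∑ m (not ∘ A) s)))))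
    where
    complement : ∀ a {x} → x ≡ (if a then x else 0) + (if not a then x else 0)
    complement true  = sym (+-identityʳ _)
    complement false = refl

  sumAll-count : ∀ m l (p : Fin m → Fin l → Bool) →
    sumAll m (λ a → count l (p a)) ≡ ∑[ a < m ] ∑[ b < l ] 𝟙 (p a b)
  sumAll-count m l p = trans (sumAll≡∑ m _) (sum-cong-≗ λ a → count≡∑ l (p a))

  ∑-const-1 : ∀ m → ∑[ i < m ] 1 ≡ m
  ∑-const-1 zero    = refl
  ∑-const-1 (suc m) = cong suc (∑-const-1 m)

  ∑∑-ordered-pairs : ∀ k → ∑[ a < k ] ∑[ b < k ] 𝟙 (a <F b) ≡ k C 2
  ∑∑-ordered-pairs zero    = refl
  ∑∑-ordered-pairs (suc k) = begin
    ∑[ b < k ] 1 + ∑[ a < k ] ∑[ b < k ] 𝟙 (a <F b)  ≡⟨ cong₂ _+_ (trans (∑-const-1 k) (sym (nC1≡n k))) (∑∑-ordered-pairs k) ⟩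
    k C 1 + k C 2                                     ≡⟨ nCk+nC[k+1]≡[n+1]C[k+1] k 1 ⟩
    suc k C 2                                         ∎
    where open Relation.Binary.PropositionalEquality.≡-Reasoning

module SelectiveFold {A : Set} (P : A → Bool) (f : A → ℕ) (_∙_ : ℕ → ℕ → ℕ) where
  open import Data.Bool using (true; false; if_then_else_)
  open import Data.List using (List; []; _∷_; foldr)
  open import Data.List.Membership.Propositional using (_∈_)
  open import Data.List.Relation.Unary.Any using (here; there)
  open import Data.Product using (∃; _,_)
  open import Data.Sum using (_⊎_; inj₁; inj₂)
  open import Relation.Binary using (Transitive)
  open import Relation.Binary.PropositionalEquality using (refl; trans)

  selectFold : ℕ → List A → ℕ
  selectFold z = foldr (λ x m → if P x then f x ∙ m else m) z

  selectFold-bound : ∀ {R : ℕ → ℕ → Set} → Transitive R →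
    (∀ a b → R (a ∙ b) a) → (∀ a b → R (a ∙ b) b) →
    ∀ {z x xs} → x ∈ xs → P x ≡ true → R (selectFold z xs) (f x)
  selectFold-bound R-trans boundˡ boundʳ {x = x} (here refl) Px rewrite Px = boundˡ (f x) _
  selectFold-bound R-trans boundˡ boundʳ {xs = y ∷ ys} (there x∈ys) Px with P y
  ... | true  = R-trans (boundʳ (f y) _) (selectFold-bound R-trans boundˡ boundʳ x∈ys Px)
  ... | false = selectFold-bound R-trans boundˡ boundʳ x∈ys Px

  selectFold-attained : (∀ a b → a ∙ b ≡ a ⊎ a ∙ b ≡ b) → ∀ z xs →
    selectFold z xs ≡ z ⊎ ∃ λ x → P x ≡ true × selectFold z xs ≡ f x
  selectFold-attained select z []       = inj₁ refl
  selectFold-attained select z (y ∷ ys) with P y in Py | selectFold-attained select z ys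
  ... | false | ih = ih
  ... | true  | ih with select (f y) (selectFold z ys)
  ...   | inj₁ here≡ = inj₂ (y , Py , here≡)
  ...   | inj₂ rest≡ with ih
  ...     | inj₁ e            = inj₁ (trans rest≡ e)
  ...     | inj₂ (x , Px , e) = inj₂ (x , Px , trans rest≡ e)

module Straddling where
  open import Data.Nat using (_+_; _≤_; _<ᵇ_; _<?_)
  open import Data.Nat.Properties using (<-cmp; ≤-<-trans)
  open import Data.Bool using (true; false; _∧_)
  open import Relation.Nullary using (yes; no)
  open import Relation.Binary using (tri<; tri≈; tri>)
  open import Relation.Binary.PropositionalEquality using (refl; sym; _≢_)
  open import Data.Empty using (⊥-elim)
  open Booleans

  data Span : (opened ended unended : Bool) → Set where
    ended      : Span true  true  false
    straddling : Span true  false true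
    unopened   : Span false false true

  span : ∀ {m M x} → m ≤ M → x ≢ M → Span (m <ᵇ x) (M <ᵇ x) (x <ᵇ M)
  span {m} {M} {x} m≤M x≢M with <-cmp M x
  ... | tri< M<x _ x≮M rewrite <ᵇ-true (≤-<-trans m≤M M<x) | <ᵇ-true M<x | <ᵇ-false x≮M = ended
  ... | tri≈ _ M≡x _ = ⊥-elim (x≢M (sym M≡x))
  ... | tri> M≮x _ x<M rewrite <ᵇ-false M≮x | <ᵇ-true x<M with m <? x
  ...   | yes m<x rewrite <ᵇ-true m<x = straddling
  ...   | no  m≮x rewrite <ᵇ-false m≮x = unopened

  opened≡ended+straddling : ∀ {op en un} → Span op en un → 𝟙 op ≡ 𝟙 en + 𝟙 (op ∧ un)
  opened≡ended+straddling ended      = refl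
  opened≡ended+straddling straddling = refl
  opened≡ended+straddling unopened   = refl

module Partition {n k : ℕ} (block : Fin n → Fin k) (surj : IsOSP block) where
  open import Data.Nat using (_+_; _≤_; _<_; _<ᵇ_; _⊓_; _⊔_; _≟_)
  open import Data.Nat.Properties
    using (≤-trans; ≤-reflexive; ≤-<-trans; <-≤-trans; <⇒≱; <-irrefl; n≤0⇒n≡0;
           ⊓-sel; ⊔-sel; m⊓n≤m; m⊓n≤n; m≤m⊔n; m≤n⊔m; <ᵇ⇒<; <⇒<ᵇ; <ᵇ-reflects-<)
  open import Data.Nat.Combinatorics using (_C_)
  open import Data.Nat.Tactic.RingSolver using (solve)
  open import Data.Bool using (true; false; not; if_then_else_; _∧_; _∨_; T)
  open import Data.Bool.Properties using (∧-comm; ∧-identityʳ)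
  import Data.Fin as Fin
  open import Data.Fin using (toℕ)
  open import Data.Fin.Properties using (toℕ-injective; toℕ<n)
  open import Data.List using (allFin; _∷_; [])
  open import Data.Bool.ListAction using (all)
  open import Data.List.Membership.Propositional.Properties using (∈-allFin)
  open import Data.Product using (Σ; _,_; proj₁; proj₂)
  open import Data.Sum using (inj₁; inj₂)
  open import Data.Empty using (⊥-elim)
  open import Function using (_∘_)
  open import Function.Bundles using (Equivalence; _⇔_; mk⇔)
  open import Relation.Nullary.Decidable using (⌊_⌋; toWitness; fromWitness)
  open import Relation.Nullary.Reflects using (det; fromEquivalence)
  open import Relation.Binary.PropositionalEquality using (refl; sym; trans; cong; cong₂; subst; subst₂; _≢_)
  open Relation.Binary.PropositionalEquality.≡-Reasoning
  open Booleans
  open FiniteSums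
  open Straddling

  minB-≤ : ∀ {j b} → block j ≡ b → minB block b ≤ toℕ j
  minB-≤ {j} {b} bj = SelectiveFold.selectFold-bound (λ i → block i ==F b) toℕ _⊓_
    ≤-trans m⊓n≤m m⊓n≤n (∈-allFin j) (⌊⌋-true (block j Fin.≟ b) bj)

  ≤-maxB : ∀ {j b} → block j ≡ b → toℕ j ≤ maxB block b
  ≤-maxB {j} {b} bj = SelectiveFold.selectFold-bound (λ i → block i ==F b) toℕ _⊔_ {R = λ x y → y ≤ x}
    (λ y≤x z≤y → ≤-trans z≤y y≤x) m≤m⊔n m≤n⊔m (∈-allFin j) (⌊⌋-true (block j Fin.≟ b) bj)

  minB-attained : ∀ b → Σ (Fin n) λ j → block j ≡ b × minB block b ≡ toℕ j
  minB-attained b with SelectiveFold.selectFold-attained (λ i → block i ==F b) toℕ _⊓_ ⊓-sel n (allFin n)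
  ... | inj₂ (j , bj , e) = j , ⌊⌋-sound (block j Fin.≟ b) bj , e
  ... | inj₁ e = let (i , bi) = surj b in ⊥-elim (<⇒≱ (toℕ<n i) (subst (_≤ toℕ i) e (minB-≤ bi)))

  maxB-attained : ∀ b → Σ (Fin n) λ j → block j ≡ b × maxB block b ≡ toℕ j
  maxB-attained b with SelectiveFold.selectFold-attained (λ i → block i ==F b) toℕ _⊔_ ⊔-sel 0 (allFin n)
  ... | inj₂ (j , bj , e) = j , ⌊⌋-sound (block j Fin.≟ b) bj , e
  ... | inj₁ e = let (i , bi) = surj b in i , bi , trans e (sym (n≤0⇒n≡0 (subst (toℕ i ≤_) e (≤-maxB bi))))

  opener closer : Fin k → Fin n
  opener b = proj₁ (minB-attained b)
  closer b = proj₁ (maxB-attained b)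

  block-opener : ∀ b → block (opener b) ≡ b
  block-opener b = proj₁ (proj₂ (minB-attained b))

  block-closer : ∀ b → block (closer b) ≡ b
  block-closer b = proj₁ (proj₂ (maxB-attained b))

  minB≡opener : ∀ b → minB block b ≡ toℕ (opener b)
  minB≡opener b = proj₂ (proj₂ (minB-attained b))

  maxB≡closer : ∀ b → maxB block b ≡ toℕ (closer b)
  maxB≡closer b = proj₂ (proj₂ (maxB-attained b))

  minB≤maxB : ∀ b → minB block b ≤ maxB block b
  minB≤maxB b = ≤-trans (minB-≤ (block-closer b)) (≤-reflexive (sym (maxB≡closer b)))

  minB-injective : ∀ {a b} → minB block a ≡ minB block b → a ≡ b
  minB-injective {a} {b} e = begin
    a                    ≡⟨ block-opener a ⟨
    block (opener a)     ≡⟨ cong block (toℕ-injective (trans (sym (minB≡opener a)) (trans e (minB≡opener b)))) ⟩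
    block (opener b)     ≡⟨ block-opener b ⟩
    b                    ∎

  toℕ≡maxB⇒block≡ : ∀ {i b} → toℕ i ≡ maxB block b → block i ≡ b
  toℕ≡maxB⇒block≡ {i} {b} e = trans (cong block (toℕ-injective (trans e (maxB≡closer b)))) (block-closer b)

  module Representatives (e : Fin k → ℕ) (rep : Fin k → Fin n)
                         (block-rep : ∀ b → block (rep b) ≡ b) (e≡rep : ∀ b → e b ≡ toℕ (rep b)) where
    isRep : Fin n → Bool
    isRep j = ⌊ toℕ j ≟ e (block j) ⌋

    sumOver-reps : ∀ (g : Fin k → ℕ → ℕ) →
      sumOver n isRep (λ j → g (block j) (toℕ j)) ≡ sumAll k (λ b → g b (e b))
    sumOver-reps g = begin
      sumOver n isRep G                           ≡⟨ sumOver≡∑ n isRep G ⟩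
      ∑[ j < n ] (if isRep j then G j else 0)     ≡⟨ sum-cong-≗ (sym ∘ repsOf) ⟩
      ∑[ j < n ] ∑[ b < k ] δ j b                 ≡⟨ ∑-comm δ ⟩
      ∑[ b < k ] ∑[ j < n ] δ j b                 ≡⟨ sum-cong-≗ repOf ⟩
      ∑[ b < k ] g b (e b)                        ≡⟨ sumAll≡∑ k _ ⟨
      sumAll k (λ b → g b (e b))                  ∎
      where
      G : Fin n → ℕ
      G j = g (block j) (toℕ j)

      δ : Fin n → Fin k → ℕ
      δ j b = if ⌊ j Fin.≟ rep b ⌋ then G j else 0

      repsOf : ∀ j → ∑[ b < k ] δ j b ≡ (if isRep j then G j else 0)
      repsOf j = begin
        ∑[ b < k ] δ j b  ≡⟨ ∑-point (δ j) (block j) (λ b b≢ → cong (if_then G j else 0)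
                               (⌊⌋-false (j Fin.≟ rep b) λ j≡ → b≢ (trans (sym (block-rep b)) (cong block (sym j≡))))) ⟩
        δ j (block j)     ≡⟨ cong (if_then G j else 0) (⌊⌋-≡ (j Fin.≟ rep (block j)) (toℕ j ≟ e (block j))
                               (λ j≡ → trans (cong toℕ j≡) (sym (e≡rep _))) (λ j≡ → toℕ-injective (trans j≡ (e≡rep _)))) ⟩
        (if isRep j then G j else 0) ∎

      repOf : ∀ b → ∑[ j < n ] δ j b ≡ g b (e b)
      repOf b = begin
        ∑[ j < n ] δ j b  ≡⟨ ∑-point (λ j → δ j b) (rep b) (λ j j≢ → cong (if_then G j else 0) (⌊⌋-false (j Fin.≟ rep b) j≢)) ⟩
        δ (rep b) b       ≡⟨ cong (if_then G (rep b) else 0) (⌊⌋-true (rep b Fin.≟ rep b) refl) ⟩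
        G (rep b)         ≡⟨ cong₂ g (block-rep b) (sym (e≡rep b)) ⟩
        g b (e b)         ∎

  open Representatives (minB block) opener block-opener minB≡opener
    using () renaming (sumOver-reps to sumOver-openers)
  open Representatives (maxB block) closer block-closer maxB≡closer
    using () renaming (sumOver-reps to sumOver-closers)

  count-openers : ∀ (q : Fin k → ℕ → Bool) →
    count n (λ j → isOpen block j ∧ q (block j) (toℕ j)) ≡ count k (λ b → q b (minB block b))
  count-openers q = trans (count-∧ n (isOpen block) _)
    (trans (sumOver-openers (λ b m → 𝟙 (q b m))) (sym (count≡sumAll k _)))

  count-closers : ∀ (q : Fin k → ℕ → Bool) →
    count n (λ j → isClos block j ∧ q (block j) (toℕ j)) ≡ count k (λ b → q b (maxB block b))
  count-closers q = trans (count-∧ n (isClos block) _)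
    (trans (sumOver-closers (λ b m → 𝟙 (q b m))) (sym (count≡sumAll k _)))

  ros-blocks : ∀ i → ros block i ≡ count k (λ b → (block i <F b) ∧ (minB block b <ᵇ toℕ i))
  ros-blocks i = trans (count-openers (λ b m → (m <ᵇ toℕ i) ∧ (block i <F b)))
    (count-cong k λ b → ∧-comm (minB block b <ᵇ toℕ i) (block i <F b))

  los-blocks : ∀ i → los block i ≡ count k (λ b → (b <F block i) ∧ (minB block b <ᵇ toℕ i))
  los-blocks i = trans (count-openers (λ b m → (m <ᵇ toℕ i) ∧ (b <F block i)))
    (count-cong k λ b → ∧-comm (minB block b <ᵇ toℕ i) (b <F block i))

  rcs-blocks : ∀ i → rcs block i ≡ count k (λ b → (block i <F b) ∧ (maxB block b <ᵇ toℕ i))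
  rcs-blocks i = trans (count-closers (λ b m → (m <ᵇ toℕ i) ∧ (block i <F b)))
    (count-cong k λ b → ∧-comm (maxB block b <ᵇ toℕ i) (block i <F b))

  lcs-blocks : ∀ i → lcs block i ≡ count k (λ b → (b <F block i) ∧ (maxB block b <ᵇ toℕ i))
  lcs-blocks i = trans (count-closers (λ b m → (m <ᵇ toℕ i) ∧ (b <F block i)))
    (count-cong k λ b → ∧-comm (maxB block b <ᵇ toℕ i) (b <F block i))

  <F⇒≢ : ∀ {a b : Fin k} → T (a <F b) → a ≢ b
  <F⇒≢ {a} a<b refl = <-irrefl refl (<ᵇ⇒< (toℕ a) (toℕ a) a<b)

  span-of : ∀ i b → block i ≢ b → Span (minB block b <ᵇ toℕ i) (maxB block b <ᵇ toℕ i) (toℕ i <ᵇ maxB block b)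
  span-of i b i∉b = span (minB≤maxB b) (i∉b ∘ toℕ≡maxB⇒block≡)

  ros≡rcs+rsb : ∀ i → ros block i ≡ rcs block i + rsb block i
  ros≡rcs+rsb i = trans (ros-blocks i) (trans
    (count-split k λ b → 𝟙-∧-split (block i <F b) λ i<b → opened≡ended+straddling (span-of i b (<F⇒≢ i<b)))
    (cong (_+ rsb block i) (sym (rcs-blocks i))))

  los≡lcs+lsb : ∀ i → los block i ≡ lcs block i + lsb block i
  los≡lcs+lsb i = trans (los-blocks i) (trans
    (count-split k λ b → 𝟙-∧-split (b <F block i) λ b<i → opened≡ended+straddling (span-of i b (<F⇒≢ b<i ∘ sym)))
    (cong (_+ lsb block i) (sym (lcs-blocks i))))

  allGreater≡ : ∀ a b → allGreater block a b ≡ (maxB block b <ᵇ minB block a)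
  allGreater≡ a b = det (fromEquivalence sound complete) (<ᵇ-reflects-< _ _)
    where
    open Equivalence
    ordered : Fin n → Fin n → Bool
    ordered x y = not (block x ==F a) ∨ not (block y ==F b) ∨ (y <F x)

    ordered⇔ : ∀ x y → T (ordered x y) ⇔ (block x ≡ a → block y ≡ b → toℕ y < toℕ x)
    ordered⇔ x y = mk⇔
      (λ ord x∈a y∈b → <ᵇ⇒< _ _ (to (T-not-∨ {block y ==F b}) (to (T-not-∨ {block x ==F a}) ord (fromWitness x∈a)) (fromWitness y∈b)))
      (λ y<x → from (T-not-∨ {block x ==F a}) λ x∈a → from (T-not-∨ {block y ==F b}) λ y∈b → <⇒<ᵇ (y<x (toWitness x∈a) (toWitness y∈b)))

    sound : T (allGreater block a b) → maxB block b < minB block a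
    sound all> = subst₂ _<_ (sym (maxB≡closer b)) (sym (minB≡opener a))
      (to (ordered⇔ (opener a) (closer b)) ordered-extremes (block-opener a) (block-closer b))
      where
      ordered-extremes : T (ordered (opener a) (closer b))
      ordered-extremes = to (all-allFin _) (to (all-allFin (λ x → all (ordered x) (allFin n))) all> (opener a)) (closer b)

    complete : maxB block b < minB block a → T (allGreater block a b)
    complete b<a = from (all-allFin _) λ x → from (all-allFin (ordered x)) λ y → from (ordered⇔ x y) λ x∈a y∈b →
      ≤-<-trans (≤-maxB y∈b) (<-≤-trans b<a (minB-≤ x∈a))

  total onOpeners onTC onOS : ((Fin n → Fin k) → Fin n → ℕ) → ℕ
  total      s = sumAll n (s block)
  onOpeners  s = sumOver n (isOpen block) (s block)
  onTC       s = sumOver n (isTC block) (s block)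
  onOS       s = sumOver n (isOS block) (s block)

  inv≡onOpeners-ros : inv block ≡ onOpeners ros
  inv≡onOpeners-ros = trans (sym (sumOver-openers λ a m → count k (λ b → (a <F b) ∧ (minB block b <ᵇ m))))
               (sumOver-cong n (λ _ → refl) (sym ∘ ros-blocks))

  bInv≡onOpeners-rcs : bInv block ≡ onOpeners rcs
  bInv≡onOpeners-rcs = begin
    bInv block
      ≡⟨ sumAll-cong k (λ a → count-cong k λ b → cong ((a <F b) ∧_) (allGreater≡ a b)) ⟩
    sumAll k (λ a → count k (λ b → (a <F b) ∧ (maxB block b <ᵇ minB block a)))
      ≡⟨ sumOver-openers (λ a m → count k (λ b → (a <F b) ∧ (maxB block b <ᵇ m))) ⟨
    sumOver n (isOpen block) (λ j → count k (λ b → (block j <F b) ∧ (maxB block b <ᵇ toℕ j)))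
      ≡⟨ sumOver-cong n (λ _ → refl) (sym ∘ rcs-blocks) ⟩
    onOpeners rcs ∎

  k-choose-2≡inv+onOpeners-los : k C 2 ≡ inv block + onOpeners los
  k-choose-2≡inv+onOpeners-los = begin
    k C 2
      ≡⟨ ∑∑-ordered-pairs k ⟨
    ∑[ a < k ] ∑[ b < k ] 𝟙 (a <F b)
      ≡⟨ sum-cong-≗ (λ a → trans (sum-cong-≗ (split a)) (∑-distrib-+ {k} _ _)) ⟩
    ∑[ a < k ] (∑[ b < k ] 𝟙 ((a <F b) ∧ (mB b <ᵇ mB a)) + ∑[ b < k ] 𝟙 ((a <F b) ∧ (mB a <ᵇ mB b)))
      ≡⟨ ∑-distrib-+ {k} _ _ ⟩
    ∑[ a < k ] ∑[ b < k ] 𝟙 ((a <F b) ∧ (mB b <ᵇ mB a)) + ∑[ a < k ] ∑[ b < k ] 𝟙 ((a <F b) ∧ (mB a <ᵇ mB b))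
      ≡⟨ cong₂ _+_ (sym (sumAll-count k k _)) (∑-comm {k} {k} _) ⟩
    inv block + ∑[ a < k ] ∑[ b < k ] 𝟙 ((b <F a) ∧ (mB b <ᵇ mB a))
      ≡⟨ cong (inv block +_) (sym (sumAll-count k k _)) ⟩
    inv block + sumAll k (λ a → count k (λ b → (b <F a) ∧ (mB b <ᵇ mB a)))
      ≡⟨ cong (inv block +_) (sym (sumOver-openers λ a m → count k (λ b → (b <F a) ∧ (mB b <ᵇ m)))) ⟩
    inv block + sumOver n (isOpen block) (λ j → count k (λ b → (b <F block j) ∧ (mB b <ᵇ toℕ j)))
      ≡⟨ cong (inv block +_) (sumOver-cong n (λ _ → refl) (sym ∘ los-blocks)) ⟩
    inv block + onOpeners los ∎
    where
    mB = minB block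
    split : ∀ a b → 𝟙 (a <F b) ≡ 𝟙 ((a <F b) ∧ (mB b <ᵇ mB a)) + 𝟙 ((a <F b) ∧ (mB a <ᵇ mB b))
    split a b = trans (cong 𝟙 (sym (∧-identityʳ (a <F b))))
      (𝟙-∧-split (a <F b) λ a<b → 𝟙-<ᵇ-split λ e → <F⇒≢ a<b (minB-injective e))

  isTC≡not-isOpen : ∀ i → isTC block i ≡ not (isOpen block i)
  isTC≡not-isOpen i = transient-or-closer (isOpen block i) (isClos block i)
    where
    transient-or-closer : ∀ o c → (not o ∧ not c) ∨ (c ∧ not o) ≡ not o
    transient-or-closer true  true  = refl
    transient-or-closer true  false = refl
    transient-or-closer false true  = refl
    transient-or-closer false false = refl

  isOS≡isOpen : ∀ i → isOS block i ≡ isOpen block i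
  isOS≡isOpen i = opener-or-singleton (isOpen block i) (isClos block i)
    where
    opener-or-singleton : ∀ o c → (o ∧ not c) ∨ (o ∧ c) ≡ o
    opener-or-singleton true  true  = refl
    opener-or-singleton true  false = refl
    opener-or-singleton false true  = refl
    opener-or-singleton false false = refl

  total≡onOpeners+onTC : ∀ s → total s ≡ onOpeners s + onTC s
  total≡onOpeners+onTC s = trans (sumAll≡sumOver+sumOver-not n (isOpen block) (s block))
    (cong (onOpeners s +_) (sumOver-cong n (sym ∘ isTC≡not-isOpen) (λ _ → refl)))

  onOS≡onOpeners : ∀ s → onOS s ≡ onOpeners s
  onOS≡onOpeners s = sumOver-cong n isOS≡isOpen (λ _ → refl)

  inv≡bInv+onOpeners-rsb : inv block ≡ bInv block + onOpeners rsb
  inv≡bInv+onOpeners-rsb = begin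
    inv block                                             ≡⟨ inv≡onOpeners-ros ⟩
    onOpeners ros                                         ≡⟨ sumOver-cong n (λ _ → refl) ros≡rcs+rsb ⟩
    sumOver n (isOpen block) (λ i → rcs block i + rsb block i) ≡⟨ sumOver-+ n (isOpen block) (rcs block) (rsb block) ⟩
    onOpeners rcs + onOpeners rsb                         ≡⟨ cong (_+ onOpeners rsb) (sym bInv≡onOpeners-rcs) ⟩
    bInv block + onOpeners rsb                            ∎

  mak+bInv-balance : (total ros + total lcs) + bInv block ≡ ((total lcs + total rcs) + onTC rsb) + inv block
  mak+bInv-balance = algebra
    (trans (sumAll-cong n ros≡rcs+rsb) (sumAll-+ n (rcs block) (rsb block)))
    (total≡onOpeners+onTC rsb)
    inv≡bInv+onOpeners-rsb
    where
    algebra : ∀ {ros lcs rcs rsb Orsb Trsb bInv inv} →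
      ros ≡ rcs + rsb → rsb ≡ Orsb + Trsb → inv ≡ bInv + Orsb →
      (ros + lcs) + bInv ≡ ((lcs + rcs) + Trsb) + inv
    algebra {lcs = lcs} {rcs} {Orsb = Orsb} {Trsb} {bInv} refl refl refl =
      solve (lcs ∷ rcs ∷ Orsb ∷ Trsb ∷ bInv ∷ [])

  -- The second and third identities with all subtractions cleared, so that they hold in ℕ.
  lmak+bInv-balance : ((onTC lcs + onTC rcs) + onTC lsb) + (k C 2 + bInv block) ≡ (total los + total rcs) + inv block
  lmak+bInv-balance = algebra (inv block) (onOpeners los) (onTC lcs) (onTC lsb) (bInv block) (onTC rcs)
    k-choose-2≡inv+onOpeners-los
    (total≡onOpeners+onTC los)
    (trans (sumOver-cong n (λ _ → refl) los≡lcs+lsb) (sumOver-+ n (isTC block) (lcs block) (lsb block)))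
    (trans (total≡onOpeners+onTC rcs) (cong (_+ onTC rcs) (sym bInv≡onOpeners-rcs)))
    where
    algebra : ∀ {C los Tlos rcs} inv Olos Tlcs Tlsb bInv Trcs →
      C ≡ inv + Olos → los ≡ Olos + Tlos → Tlos ≡ Tlcs + Tlsb → rcs ≡ bInv + Trcs →
      ((Tlcs + Trcs) + Tlsb) + (C + bInv) ≡ (los + rcs) + inv
    algebra inv Olos Tlcs Tlsb bInv Trcs refl refl refl refl = solve (inv ∷ Olos ∷ Tlcs ∷ Tlsb ∷ bInv ∷ Trcs ∷ [])

  cinvLSB-balance : total lsb + inv block ≡ ((onOS lsb + onOS rsb) + onTC lsb) + bInv block
  cinvLSB-balance = algebra
    (total≡onOpeners+onTC lsb)
    inv≡bInv+onOpeners-rsb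
    (onOS≡onOpeners lsb)
    (onOS≡onOpeners rsb)
    where
    algebra : ∀ {lsb Olsb Tlsb inv bInv Orsb OSlsb OSrsb} →
      lsb ≡ Olsb + Tlsb → inv ≡ bInv + Orsb → OSlsb ≡ Olsb → OSrsb ≡ Orsb →
      lsb + inv ≡ ((OSlsb + OSrsb) + Tlsb) + bInv
    algebra {Olsb = Olsb} {Tlsb} {bInv = bInv} {Orsb} refl refl refl refl =
      solve (Olsb ∷ Tlsb ∷ bInv ∷ Orsb ∷ [])

open import Data.Integer using (ℤ; +_; _+_; _-_; _*_)
open import Data.Integer.Properties using (+-inverseʳ; +-identityʳ)
open import Data.Integer.Tactic.RingSolver using (solve)
open import Data.List using (_∷_; [])
open import Data.Nat.Combinatorics using (_C_)
open import Data.Product using (_,_)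
open import Relation.Binary.PropositionalEquality using (refl; trans; cong)

≡-by-difference : ∀ {x y p q : ℤ} → x ≡ y + (p - q) → p ≡ q → x ≡ y
≡-by-difference {y = y} {p} x≡y+0 refl = trans x≡y+0 (trans (cong (λ z → y + z) (+-inverseʳ p)) (+-identityʳ y))

lmak-rearrangement : ∀ N los rcs Tlcs Trcs Tlsb C inv bInv →
  ((Tlcs + Trcs) + Tlsb) + (C + bInv) ≡ (los + rcs) + inv →
  (N - (los + rcs)) + bInv ≡ ((N - (Tlcs + Trcs)) - Tlsb) - (C - inv)
lmak-rearrangement N los rcs Tlcs Trcs Tlsb C inv bInv =
  ≡-by-difference (solve (N ∷ los ∷ rcs ∷ Tlcs ∷ Trcs ∷ Tlsb ∷ C ∷ inv ∷ bInv ∷ []))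

cinvLSB-rearrangement : ∀ lsb C bInv OSlsb OSrsb Tlsb inv →
  lsb + inv ≡ ((OSlsb + OSrsb) + Tlsb) + bInv →
  (lsb + (C - bInv)) + C ≡ (((OSlsb + OSrsb) + Tlsb) + inv) + + 2 * (C - inv)
cinvLSB-rearrangement lsb C bInv OSlsb OSrsb Tlsb inv =
  ≡-by-difference (solve (lsb ∷ C ∷ bInv ∷ OSlsb ∷ OSrsb ∷ Tlsb ∷ inv ∷ []))

lemma3p10 : (n k : ℕ) → n ≥ 1 → k ≥ 1 → (block : Fin n → Fin k) → IsOSP block →
    (mak block + + bInv block
      ≡ ((tot block (lcs block) + tot block (rcs block))
          + totOn block (isTC block) (rsb block))
          + + inv block)
    × (lmak block + + bInv block
      ≡ (((+ n * (+ k - + 1))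
          - (totOn block (isTC block) (lcs block) + totOn block (isTC block) (rcs block)))
          - totOn block (isTC block) (lsb block))
          - cinv block)
    × (cinvLSB block
      ≡ (((totOn block (isOS block) (lsb block) + totOn block (isOS block) (rsb block))
          + totOn block (isTC block) (lsb block))
          + + inv block)
          + + 2 * cinv block)
lemma3p10 n k _ _ block surj =
    cong +_ mak+bInv-balance
  , lmak-rearrangement (+ n * (+ k - + 1)) (+ total los) (+ total rcs) (+ onTC lcs) (+ onTC rcs) (+ onTC lsb)
      (+ (k C 2)) (+ inv block) (+ bInv block) (cong +_ lmak+bInv-balance)
  , cinvLSB-rearrangement (+ total lsb) (+ (k C 2)) (+ bInv block) (+ onOS lsb) (+ onOS rsb) (+ onTC lsb)
      (+ inv block) (cong +_ cinvLSB-balance)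
  where open Partition block surj
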